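{- Let $d\ge 2$, $r\ge 1$ and $n\ge 1$ be integers. Then $$p^{(d)}(n,r)=\sum_{i\ge 1}\hat{p}^{(1)}_i\!\left(n-(r-1)i-(d-2)\binom{i}{2}\right),$$ where $p^{(d)}(n,r)$ is the number of partitions of $n$ with $d$-distant parts whose smallest part is at least $r$, and, for an integer $m$ and $i\ge1$, $\hat{p}^{(1)}_i(m)$ is the number of partitions of $m$ into exactly $i$ distinct parts whose smallest even part is greater than twice the number of odd parts (with $\hat{p}^{(1)}_i(m)=0$ for $m\le 0$).
   Context: A partition of $n$ is a non-increasing sequence of positive integers $\lambda_1\ge\cdots\ge\lambda_l$ summing to $n$; it has $d$-distant parts if $\lambda_j-\lambda_{j+1}\ge d$ for all $j<l$ (so $1$-distant means all parts are distinct). For a partition $\mu$ with distinct parts, $l_o(\mu)$ denotes its number of odd parts and $e(\mu)$ its smallest even part; the condition "smallest even part greater than twice the number of odd parts" means $e(\mu)>2l_o(\mu)$, and it is regarded as satisfied when $\mu$ has no even parts. -}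

module Defs where

open import Data.Nat using (ℕ; zero; suc; _+_; _*_; _∸_; _≤_; _<_; _≥_; _≤?_; _≟_)
open import Data.Nat.Divisibility using (_∣_; _∣?_)
open import Data.Nat.Combinatorics using (_C_)
open import Data.Integer as ℤ using (ℤ; +_; -[1+_])
open import Data.Nat.ListAction using (sum)
open import Data.List using (List; []; _∷_; length; filter; map; concatMap; upTo)
open import Data.List.Relation.Unary.All using (All; all?)
open import Data.List.Relation.Unary.Linked using (Linked; linked?)
open import Data.Product using (_×_)
open import Relation.Nullary using (¬_; Dec; ¬?)
open import Relation.Nullary.Decidable using (_×-dec_)

candidates : ℕ → ℕ → List (List ℕ)
candidates n zero    = [] ∷ []
candidates n (suc l) = [] ∷ concatMap (λ x → map (x ∷_) (candidates n l)) (map suc (upTo n))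

IsPartitionOf : ℕ → List ℕ → Set
IsPartitionOf n μ = All (1 ≤_) μ × Linked (λ x y → y ≤ x) μ × sum μ ≡ n
  where open import Relation.Binary.PropositionalEquality using (_≡_)

isPartitionOf? : (n : ℕ) → (μ : List ℕ) → Dec (IsPartitionOf n μ)
isPartitionOf? n μ = all? (1 ≤?_) μ ×-dec (linked? (λ x y → y ≤? x) μ ×-dec (sum μ ≟ n))

-- The list of all partitions of n (every partition of n has at most n
-- parts, each of size at most n).
partitions : ℕ → List (List ℕ)
partitions n = filter (isPartitionOf? n) (candidates n n)

Distant : ℕ → List ℕ → Set
Distant d = Linked (λ x y → d + y ≤ x)

distant? : (d : ℕ) → (μ : List ℕ) → Dec (Distant d μ)
distant? d = linked? (λ x y → d + y ≤? x)

SmallestAtLeast : ℕ → List ℕ → Set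
SmallestAtLeast r = All (r ≤_)

smallestAtLeast? : (r : ℕ) → (μ : List ℕ) → Dec (SmallestAtLeast r μ)
smallestAtLeast? r = all? (r ≤?_)

p : ℕ → ℕ → ℕ → ℕ
p d n r = length (filter (λ μ → distant? d μ ×-dec smallestAtLeast? r μ) (partitions n))

lo : List ℕ → ℕ
lo μ = length (filter (λ x → ¬? (2 ∣? x)) μ)

-- e(μ) > 2 l_o(μ), where e(μ) is the smallest even part; vacuous when
-- μ has no even parts.  Equivalently: every even part exceeds 2 l_o(μ).
EvenCond : List ℕ → Set
EvenCond μ = All (λ x → 2 ∣ x → 2 * lo μ < x) μ

evenCond? : (μ : List ℕ) → Dec (EvenCond μ)
evenCond? μ = all? (λ x → dec x) μ
  where
  open import Relation.Nullary.Decidable using (_→-dec_)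
  dec : (x : ℕ) → Dec (2 ∣ x → 2 * lo μ < x)
  dec x = (2 ∣? x) →-dec (suc (2 * lo μ) ≤? x)

phatℕ : ℕ → ℕ → ℕ
phatℕ i m = length (filter (λ μ → distant? 1 μ ×-dec (length μ ≟ i) ×-dec evenCond? μ) (partitions m))

phat : ℕ → ℤ → ℤ
phat i (+ zero)    = + 0
phat i (+ suc m)   = + phatℕ i (suc m)
phat i -[1+ m ]    = + 0

sumFrom1 : ℕ → (ℕ → ℤ) → ℤ
sumFrom1 zero    f = + 0
sumFrom1 (suc M) f = sumFrom1 M f ℤ.+ f (suc M)

-- Both sides are sorted by the number i of parts: p^(d)(n,r) is the sum over i of the number of d-distant
-- partitions of n into i parts that are all ≥ r, and with m = n − (r−1)i − (d−2)C(i,2) these are shown to be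
-- equinumerous with the partitions counted by p̂ᵢ(m), by strong induction on m.  Each family splits according
-- to its smallest part, and each half is in bijection with a family of smaller m:
--   * d-distant, smallest part r: drop it and lower the other parts by d        — i − 1 parts, m − (2i − 1);
--   * d-distant, all parts > r:   lower every part by 1                         — i parts,     m − i;
--   * p̂, smallest part 1:         drop it and lower the other parts by 2        — i − 1 parts, m − (2i − 1);
--   * p̂, all parts ≥ 2:           with k odd and a even parts, send each even part e to the odd part
--                                 e − 2k − 1 and each odd part o to the even part o − 1 + 2a — i parts, m − i.
-- In the last map the image has a odd parts and its even parts are the o − 1 + 2a > 2a, so it again satisfies
-- the condition on even parts; conversely, e > 2k is what keeps e − 2k − 1 positive.

module Submission where

open import Defs
open import Data.Nat using (ℕ; zero; suc; _+_; _*_; _∸_; _≤_; _<_; _≤?_; _≟_; z≤n; s≤s; parity)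
open import Data.Nat.Properties
open import Data.Nat.Combinatorics using (_C_; nCk+nC[k+1]≡[n+1]C[k+1]; nC1≡n)
open import Data.Nat.Divisibility using (_∣_; _∣?_; divides)
open import Data.Nat.Induction using (<-rec)
open import Data.Nat.ListAction using (sum)
open import Data.Nat.ListAction.Properties using (sum-++; sum-↭)
open import Data.Nat.Tactic.RingSolver using (solve-∀)
open import Data.Parity.Base as ℙ using (0ℙ; 1ℙ)
open import Data.Parity.Properties as ℙₚ using (+-homo-+; *-homo-*; suc-homo-⁻¹)
open import Data.Bool using (true; false)
open import Data.Empty using (⊥; ⊥-elim)
open import Data.Product using (∃; _×_; _,_; proj₁; proj₂)
open import Data.Sum using (_⊎_; inj₁; inj₂)
open import Data.List using (List; []; _∷_; length; map; filter; merge; drop; upTo; concatMap; reverse; _++_)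
open import Data.List.Properties
  using (length-map; length-++; length-reverse; map-∘; map-id-local; filter-accept; filter-reject;
         filter-all; filter-none; filter-≐; reverse-involutive; unfold-reverse; ∷-injectiveˡ; ∷-injectiveʳ)
open import Data.List.Relation.Unary.All as All using (All; []; _∷_)
import Data.List.Relation.Unary.All.Properties as All
open import Data.List.Relation.Unary.AllPairs as AllPairs using (AllPairs; []; _∷_)
import Data.List.Relation.Unary.AllPairs.Properties as AllPairs
open import Data.List.Relation.Unary.Any as Any using (here; there)
import Data.List.Relation.Unary.Linked.Properties as Linked
open import Data.List.Relation.Unary.Unique.Propositional using (Unique)
import Data.List.Relation.Unary.Unique.Propositional.Properties as Unique
open import Data.List.Relation.Binary.Disjoint.Propositional using (Disjoint)
open import Data.List.Membership.Propositional using (_∈_)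
open import Data.List.Membership.Propositional.Properties
  using (∈-map⁺; ∈-map⁻; ∈-++⁺ˡ; ∈-++⁺ʳ; ∈-++⁻; ∈-filter⁺; ∈-filter⁻;
         ∈-concatMap⁺; ∈-concatMap⁻; ∈-upTo⁺)
open import Data.List.Membership.Propositional.Properties.WithK using (unique∧set⇒bag)
open import Data.List.Relation.Binary.BagAndSetEquality using (∼bag⇒↭)
open import Data.List.Relation.Binary.Permutation.Propositional using (↭-sym)
open import Data.List.Relation.Binary.Permutation.Propositional.Properties
  using (↭-length; ↭-reverse; merge-↭; All-resp-↭; filter-↭)
open import Function using (_∘_; flip; id; mk⇔)
open import Relation.Binary.PropositionalEquality
import Relation.Binary.Definitions as B
open import Relation.Binary.Definitions using (tri<; tri≈; tri>)
open import Relation.Nullary using (¬_; Dec; yes; no; ¬?; does)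
import Relation.Nullary.Decidable as Dec
open import Relation.Nullary.Decidable using (_×-dec_)
open import Relation.Unary using (Decidable)

map-inverse : ∀ {A B : Set} {f : B → A} {g : A → B} {xs} →
              All (λ x → f (g x) ≡ x) xs → map f (map g xs) ≡ xs
map-inverse {xs = xs} fg = trans (sym (map-∘ xs)) (map-id-local fg)

record Card {A : Set} (P : A → Set) (c : ℕ) : Set where
  field
    elements : List A
    unique   : Unique elements
    sound    : ∀ {x} → x ∈ elements → P x
    complete : ∀ {x} → P x → x ∈ elements
    length≡  : length elements ≡ c

module _ {A : Set} where

  Card-unique : ∀ {P Q : A → Set} {a b} → Card P a → Card Q b →
                (∀ {x} → P x → Q x) → (∀ {x} → Q x → P x) → a ≡ b
  Card-unique CP CQ P⊆Q Q⊆P =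
    trans (sym (Card.length≡ CP)) (trans (↭-length (∼bag⇒↭ bag)) (Card.length≡ CQ))
    where
    bag = unique∧set⇒bag (Card.unique CP) (Card.unique CQ)
            (mk⇔ (λ x∈ → Card.complete CQ (P⊆Q (Card.sound CP x∈)))
                 (λ x∈ → Card.complete CP (Q⊆P (Card.sound CQ x∈))))

  Card-∅ : ∀ {P : A → Set} → (∀ {x} → ¬ P x) → Card P 0
  Card-∅ ¬P = record
    { elements = [] ; unique = [] ; sound = λ () ; complete = λ px → ⊥-elim (¬P px) ; length≡ = refl }

  Card-singleton : ∀ {P : A → Set} x → P x → (∀ {y} → P y → y ≡ x) → Card P 1
  Card-singleton x px only = record
    { elements = x ∷ [] ; unique = [] ∷ [] ; sound = λ { (here refl) → px }
    ; complete = λ py → here (only py) ; length≡ = refl }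

  Card-filter : ∀ {P : A → Set} (P? : Decidable P) (xs : List A) → Unique xs →
                Card (λ x → x ∈ xs × P x) (length (filter P? xs))
  Card-filter P? xs u = record
    { elements = filter P? xs ; unique = Unique.filter⁺ P? u ; sound = ∈-filter⁻ P?
    ; complete = λ (x∈ , px) → ∈-filter⁺ P? x∈ px ; length≡ = refl }

  Card-⊎ : ∀ {P Q R : A → Set} {a b} → Card P a → Card Q b → (∀ {x} → P x → Q x → ⊥) →
           (∀ {x} → R x → P x ⊎ Q x) → (∀ {x} → P x → R x) → (∀ {x} → Q x → R x) →
           Card R (a + b)
  Card-⊎ {P} {Q} {R} CP CQ disjoint split P⊆R Q⊆R = record
    { elements = xs ++ ys
    ; unique = Unique.++⁺ (Card.unique CP) (Card.unique CQ)
                 (λ (x∈xs , x∈ys) → disjoint (Card.sound CP x∈xs) (Card.sound CQ x∈ys))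
    ; sound = sound
    ; complete = complete
    ; length≡ = trans (length-++ xs) (cong₂ _+_ (Card.length≡ CP) (Card.length≡ CQ)) }
    where
    xs = Card.elements CP
    ys = Card.elements CQ
    sound : ∀ {x} → x ∈ xs ++ ys → R x
    sound x∈ with ∈-++⁻ xs x∈
    ... | inj₁ x∈xs = P⊆R (Card.sound CP x∈xs)
    ... | inj₂ x∈ys = Q⊆R (Card.sound CQ x∈ys)
    complete : ∀ {x} → R x → x ∈ xs ++ ys
    complete rx with split rx
    ... | inj₁ px = ∈-++⁺ˡ (Card.complete CP px)
    ... | inj₂ qx = ∈-++⁺ʳ xs (Card.complete CQ qx)

module _ {A B : Set} {P : A → Set} {Q : B → Set} (f : A → B) (g : B → A)
         (f-sound : ∀ {x} → P x → Q (f x)) (g-sound : ∀ {y} → Q y → P (g y))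
         (g∘f : ∀ {x} → P x → g (f x) ≡ x) (f∘g : ∀ {y} → Q y → f (g y) ≡ y) where

  Card-bijection : ∀ {c} → Card P c → Card Q c
  Card-bijection CP = record
    { elements = map f xs
    ; unique = Unique.map⁻ (subst Unique (sym g∘f-xs) (Card.unique CP))
    ; sound = sound
    ; complete = λ qy → subst (_∈ map f xs) (f∘g qy) (∈-map⁺ f (Card.complete CP (g-sound qy)))
    ; length≡ = trans (length-map f xs) (Card.length≡ CP) }
    where
    xs = Card.elements CP
    g∘f-xs : map g (map f xs) ≡ xs
    g∘f-xs = map-inverse (All.tabulate (λ x∈ → g∘f (Card.sound CP x∈)))
    sound : ∀ {y} → y ∈ map f xs → Q y
    sound y∈ with ∈-map⁻ f y∈
    ... | x , x∈ , refl = f-sound (Card.sound CP x∈)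

Equinumerous : (List ℕ → Set) → (List ℕ → Set) → Set
Equinumerous P Q = ∃ λ c → Card P c × Card Q c

record Even (n : ℕ) : Set where
  constructor even
  field parity≡0ℙ : parity n ≡ 0ℙ

record Odd (n : ℕ) : Set where
  constructor odd
  field parity≡1ℙ : parity n ≡ 1ℙ

odd? : Decidable Odd
odd? n = Dec.map′ odd Odd.parity≡1ℙ (parity n ℙₚ.≟ 1ℙ)

even? : Decidable Even
even? n = Dec.map′ even Even.parity≡0ℙ (parity n ℙₚ.≟ 0ℙ)

odd⇒¬even : ∀ {n} → Odd n → ¬ Even n
odd⇒¬even (odd eq₁) (even eq₀) with trans (sym eq₁) eq₀
... | ()

¬odd⇒even : ∀ {n} → ¬ Odd n → Even n
¬odd⇒even {n} ¬o with parity n in eq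
... | 0ℙ = even eq
... | 1ℙ = ⊥-elim (¬o (odd eq))

odds evens : List ℕ → List ℕ
odds  = filter odd?
evens = filter even?

parity-2*+ : ∀ k n → parity (2 * k + n) ≡ parity n
parity-2*+ k n = trans (+-homo-+ (2 * k) n) (cong (ℙ._+ parity n) (*-homo-* 2 k))

parity-suc : ∀ n → parity (suc n) ≡ parity n ℙ.⁻¹
parity-suc n = sym (ℙₚ.⁻¹-selfInverse (suc-homo-⁻¹ n))

even-2* : ∀ k → Even (2 * k)
even-2* k = even (*-homo-* 2 k)

even-suc : ∀ {n} → Odd n → Even (suc n)
even-suc {n} (odd eq) = even (trans (parity-suc n) (cong ℙ._⁻¹ eq))

odd-suc : ∀ {n} → Even n → Odd (suc n)
odd-suc {n} (even eq) = odd (trans (parity-suc n) (cong ℙ._⁻¹ eq))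

even-pred : ∀ {n} → Odd (suc n) → Even n
even-pred {n} (odd eq) = even (trans (sym (suc-homo-⁻¹ n)) (cong ℙ._⁻¹ eq))

odd-pred : ∀ {n} → Even (suc n) → Odd n
odd-pred {n} (even eq) = odd (trans (sym (suc-homo-⁻¹ n)) (cong ℙ._⁻¹ eq))

even-2*+ : ∀ k {n} → Even n → Even (2 * k + n)
even-2*+ k {n} (even eq) = even (trans (parity-2*+ k n) eq)

odd-2*+ : ∀ k {n} → Odd n → Odd (2 * k + n)
odd-2*+ k {n} (odd eq) = odd (trans (parity-2*+ k n) eq)

even-∸2* : ∀ k {n} → 2 * k ≤ n → Even n → Even (n ∸ 2 * k)
even-∸2* k {n} 2k≤n (even eq) =
  even (trans (sym (parity-2*+ k (n ∸ 2 * k))) (trans (cong parity (m+[n∸m]≡n 2k≤n)) eq))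

even-> : ∀ k {n} → Even n → 2 * k < n → 2 + 2 * k ≤ n
even-> k e 2k<n = ≤∧≢⇒< 2k<n (λ { refl → odd⇒¬even (odd-suc (even-2* k)) e })

even⇒∣ : ∀ {n} → Even n → 2 ∣ n
even⇒∣ {zero}        _          = divides 0 refl
even⇒∣ {suc (suc n)} (even eq) with even⇒∣ {n} (even eq)
... | divides q refl = divides (suc q) refl

∣⇒even : ∀ {n} → 2 ∣ n → Even n
∣⇒even (divides q refl) = even (trans (*-homo-* q 2) (ℙₚ.*-zeroʳ (parity q)))

module _ {P : ℕ → Set} (P? : Decidable P) {R : ℕ → ℕ → Set} (R? : ∀ x y → Dec (R x y)) where

  private
    filter-∷-cong : ∀ x {l l′} → filter P? l ≡ filter P? l′ → filter P? (x ∷ l) ≡ filter P? (x ∷ l′)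
    filter-∷-cong x eq with does (P? x)
    ... | true  = cong (x ∷_) eq
    ... | false = eq

  filter-merge-noneʳ : ∀ xs {ys} → All (¬_ ∘ P) ys → filter P? (merge R? xs ys) ≡ filter P? xs
  filter-merge-noneʳ []       ¬ps = filter-none P? ¬ps
  filter-merge-noneʳ (x ∷ xs) {[]}     [] = refl
  filter-merge-noneʳ (x ∷ xs) {y ∷ ys} (¬py ∷ ¬ps)
    with does (R? x y) | filter-merge-noneʳ xs (¬py ∷ ¬ps) | filter-merge-noneʳ (x ∷ xs) ¬ps
  ... | true  | eq | _  = filter-∷-cong x eq
  ... | false | _  | eq = trans (filter-reject P? ¬py) eq

  filter-merge-noneˡ : ∀ {xs} ys → All (¬_ ∘ P) xs → filter P? (merge R? xs ys) ≡ filter P? ys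
  filter-merge-noneˡ {[]}     ys       []  = refl
  filter-merge-noneˡ {x ∷ xs} []       ¬ps = filter-none P? ¬ps
  filter-merge-noneˡ {x ∷ xs} (y ∷ ys) (¬px ∷ ¬ps)
    with does (R? x y) | filter-merge-noneˡ (y ∷ ys) ¬ps | filter-merge-noneˡ ys (¬px ∷ ¬ps)
  ... | true  | eq | _  = trans (filter-reject P? ¬px) eq
  ... | false | _  | eq = filter-∷-cong y eq

All-filter⁺ : ∀ {P Q : ℕ → Set} (P? : Decidable P) {xs} →
              All (λ x → P x → Q x) xs → All Q (filter P? xs)
All-filter⁺ P? [] = []
All-filter⁺ P? {x ∷ _} (qx ∷ qxs) with P? x
... | yes px = qx px ∷ All-filter⁺ P? qxs
... | no  _  = All-filter⁺ P? qxs

AllPairs-filter⁺ : ∀ {P : ℕ → Set} (P? : Decidable P) {R : ℕ → ℕ → Set} {xs} →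
                   AllPairs R xs → AllPairs R (filter P? xs)
AllPairs-filter⁺ P? [] = []
AllPairs-filter⁺ P? {xs = x ∷ _} (rx ∷ rxs) with does (P? x)
... | true  = All.filter⁺ P? rx ∷ AllPairs-filter⁺ P? rxs
... | false = AllPairs-filter⁺ P? rxs

-- Abstract in the decision procedure: for the concrete `_≤?_` of ℕ, `merge` unfolds to a test on `x ≤ᵇ y`,
-- which `with x ≤? y` cannot abstract over.
module Merge (_≤?_ : B.Decidable _≤_) where

  All-merge : ∀ {Q : ℕ → Set} {xs ys} → All Q xs → All Q ys → All Q (merge _≤?_ xs ys)
  All-merge {xs = xs} {ys} qxs qys = All-resp-↭ (↭-sym (merge-↭ _≤?_ xs ys)) (All.++⁺ qxs qys)

  length-merge : ∀ xs ys → length (merge _≤?_ xs ys) ≡ length xs + length ys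
  length-merge xs ys = trans (↭-length (merge-↭ _≤?_ xs ys)) (length-++ xs)

  sum-merge : ∀ xs ys → sum (merge _≤?_ xs ys) ≡ sum xs + sum ys
  sum-merge xs ys = trans (sum-↭ (merge-↭ _≤?_ xs ys)) (sum-++ xs ys)

  merge-∷ˡ : ∀ {x} xs ys → All (x <_) ys → merge _≤?_ (x ∷ xs) ys ≡ x ∷ merge _≤?_ xs ys
  merge-∷ˡ []       []       _          = refl
  merge-∷ˡ (_ ∷ _)  []       _          = refl
  merge-∷ˡ {x} xs   (y ∷ ys) (x<y ∷ _) with x ≤? y
  ... | yes _   = refl
  ... | no  x≰y = ⊥-elim (x≰y (<⇒≤ x<y))

  merge-∷ʳ : ∀ {y} xs ys → All (y <_) xs → merge _≤?_ xs (y ∷ ys) ≡ y ∷ merge _≤?_ xs ys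
  merge-∷ʳ []           ys _         = refl
  merge-∷ʳ {y} (x ∷ xs) ys (y<x ∷ _) with x ≤? y
  ... | yes x≤y = ⊥-elim (<⇒≱ y<x x≤y)
  ... | no  _   = refl

  module _ {P Q : ℕ → Set} (P? : Decidable P) (Q? : Decidable Q) where

    merge-filter : (∀ {x} → P x → ¬ Q x) → (∀ {x} → ¬ P x → Q x) →
                   ∀ {z} → AllPairs _<_ z → merge _≤?_ (filter P? z) (filter Q? z) ≡ z
    merge-filter P⇒¬Q ¬P⇒Q {[]}    []           = refl
    merge-filter P⇒¬Q ¬P⇒Q {x ∷ z} (x<z ∷ <z) = by-cases (P? x)
      where
      open ≡-Reasoning
      by-cases : Dec (P x) → merge _≤?_ (filter P? (x ∷ z)) (filter Q? (x ∷ z)) ≡ x ∷ z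
      by-cases (yes px) = begin
        merge _≤?_ (filter P? (x ∷ z)) (filter Q? (x ∷ z))
          ≡⟨ cong₂ (merge _≤?_) (filter-accept P? px) (filter-reject Q? (P⇒¬Q px)) ⟩
        merge _≤?_ (x ∷ filter P? z) (filter Q? z)
          ≡⟨ merge-∷ˡ (filter P? z) (filter Q? z) (All.filter⁺ Q? x<z) ⟩
        x ∷ merge _≤?_ (filter P? z) (filter Q? z)
          ≡⟨ cong (x ∷_) (merge-filter P⇒¬Q ¬P⇒Q <z) ⟩
        x ∷ z ∎
      by-cases (no ¬px) = begin
        merge _≤?_ (filter P? (x ∷ z)) (filter Q? (x ∷ z))
          ≡⟨ cong₂ (merge _≤?_) (filter-reject P? ¬px) (filter-accept Q? (¬P⇒Q ¬px)) ⟩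
        merge _≤?_ (filter P? z) (x ∷ filter Q? z)
          ≡⟨ merge-∷ʳ (filter P? z) (filter Q? z) (All.filter⁺ P? x<z) ⟩
        x ∷ merge _≤?_ (filter P? z) (filter Q? z)
          ≡⟨ cong (x ∷_) (merge-filter P⇒¬Q ¬P⇒Q <z) ⟩
        x ∷ z ∎

  merge-increasing : ∀ {P Q : ℕ → Set} → (∀ {x} → P x → ¬ Q x) →
                     ∀ {xs ys} → AllPairs _<_ xs → AllPairs _<_ ys → All P xs → All Q ys → AllPairs _<_ (merge _≤?_ xs ys)
  merge-increasing P⇒¬Q {[]}     {ys}     _  <ys _  _  = <ys
  merge-increasing P⇒¬Q {x ∷ xs} {[]}     <xs _  _  _  = <xs
  merge-increasing P⇒¬Q {x ∷ xs} {y ∷ ys} (x<xs ∷ <xs) (y<ys ∷ <ys) (px ∷ pxs) (qy ∷ qys)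
    with x ≤? y | merge-increasing P⇒¬Q <xs (y<ys ∷ <ys) pxs (qy ∷ qys)
         | merge-increasing P⇒¬Q (x<xs ∷ <xs) <ys (px ∷ pxs) qys
  ... | yes x≤y | rec | _ = All-merge x<xs (x<y ∷ All.map (<-trans x<y) y<ys) ∷ rec
    where
    x<y : x < y
    x<y = ≤∧≢⇒< x≤y (λ { refl → P⇒¬Q px qy })
  ... | no  x≰y | _ | rec = All-merge (y<x ∷ All.map (<-trans y<x) x<xs) y<ys ∷ rec
    where
    y<x : y < x
    y<x = ≰⇒> x≰y

open Merge _≤?_

odds-merge : ∀ {O E} → All Odd O → All Even E → odds (merge _≤?_ O E) ≡ O
odds-merge {O} odd-O even-E =
  trans (filter-merge-noneʳ odd? _≤?_ O (All.map (λ e o → odd⇒¬even o e) even-E)) (filter-all odd? odd-O)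

evens-merge : ∀ {O E} → All Odd O → All Even E → evens (merge _≤?_ O E) ≡ E
evens-merge {O} {E} odd-O even-E =
  trans (filter-merge-noneˡ even? _≤?_ E (All.map odd⇒¬even odd-O)) (filter-all even? even-E)

merge-odds-evens : ∀ {z} → AllPairs _<_ z → merge _≤?_ (odds z) (evens z) ≡ z
merge-odds-evens = merge-filter odd? even? odd⇒¬even ¬odd⇒even

merge-odds-evens-increasing : ∀ {O E} → AllPairs _<_ O → AllPairs _<_ E → All Odd O → All Even E →
                              AllPairs _<_ (merge _≤?_ O E)
merge-odds-evens-increasing = merge-increasing odd⇒¬even

length-odds-evens : ∀ {z} → AllPairs _<_ z → length (odds z) + length (evens z) ≡ length z
length-odds-evens {z} <z = trans (sym (length-merge (odds z) (evens z))) (cong length (merge-odds-evens <z))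

sum-odds-evens : ∀ {z} → AllPairs _<_ z → sum (odds z) + sum (evens z) ≡ sum z
sum-odds-evens {z} <z = trans (sym (sum-merge (odds z) (evens z))) (cong sum (merge-odds-evens <z))

sum-map-+ : ∀ c xs → sum (map (c +_) xs) ≡ c * length xs + sum xs
sum-map-+ c []       = sym (cong (_+ 0) (*-zeroʳ c))
sum-map-+ c (x ∷ xs) = begin
  c + x + sum (map (c +_) xs)      ≡⟨ cong (c + x +_) (sum-map-+ c xs) ⟩
  c + x + (c * length xs + sum xs) ≡⟨ rearrange c x (length xs) (sum xs) ⟩
  c * suc (length xs) + (x + sum xs) ∎
  where
  open ≡-Reasoning
  rearrange : ∀ c x l s → c + x + (c * l + s) ≡ c * suc l + (x + s)
  rearrange = solve-∀

map-∸-+ : ∀ c xs → map (_∸ c) (map (c +_) xs) ≡ xs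
map-∸-+ c xs = map-inverse (All.tabulate λ {x} _ → m+n∸m≡n c x)

map-+-∸ : ∀ c {xs} → All (c ≤_) xs → map (c +_) (map (_∸ c) xs) ≡ xs
map-+-∸ c c≤xs = map-inverse (All.map m+[n∸m]≡n c≤xs)

sum-map-∸ : ∀ c {xs} → All (c ≤_) xs → sum xs ≡ c * length xs + sum (map (_∸ c) xs)
sum-map-∸ c {xs} c≤xs = begin
  sum xs                                            ≡⟨ cong sum (map-+-∸ c c≤xs) ⟨
  sum (map (c +_) (map (_∸ c) xs))                  ≡⟨ sum-map-+ c (map (_∸ c) xs) ⟩
  c * length (map (_∸ c) xs) + sum (map (_∸ c) xs)  ≡⟨ cong (λ l → c * l + sum (map (_∸ c) xs)) (length-map _ xs) ⟩
  c * length xs + sum (map (_∸ c) xs)               ∎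
  where open ≡-Reasoning

map-increasing : ∀ {Q : ℕ → Set} {f : ℕ → ℕ} {xs} → (∀ {a b} → Q a → a < b → f a < f b) →
                 All Q xs → AllPairs _<_ xs → AllPairs _<_ (map f xs)
map-increasing mono [] [] = []
map-increasing mono (qx ∷ qxs) (x<xs ∷ <xs) =
  All.map⁺ (All.map (mono qx) x<xs) ∷ map-increasing mono qxs <xs

StartsWith : ℕ → List ℕ → Set
StartsWith c z = ∃ λ w → z ≡ c ∷ w

StartsWith-split : ∀ {c x w} → c ≤ x → All (x ≤_) w → StartsWith c (x ∷ w) ⊎ All (suc c ≤_) (x ∷ w)
StartsWith-split {c} {x} {w} c≤x x≤w with c ≟ x
... | yes refl = inj₁ (w , refl)
... | no  c≢x  = inj₂ (c<x ∷ All.map (<-≤-trans c<x) x≤w)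
  where
  c<x : c < x
  c<x = ≤∧≢⇒< c≤x c≢x

Card-split : ∀ {P : List ℕ → Set} {c a b} → (∀ {z} → P z → StartsWith c z ⊎ All (suc c ≤_) z) →
             Card (λ z → P z × StartsWith c z) a → Card (λ z → P z × All (suc c ≤_) z) b → Card P (a + b)
Card-split {P} {c} split CS CA = Card-⊎ CS CA disjoint cases proj₁ proj₁
  where
  disjoint : ∀ {z} → P z × StartsWith c z → P z × All (suc c ≤_) z → ⊥
  disjoint (_ , _ , refl) (_ , c<c ∷ _) = <-irrefl refl c<c
  cases : ∀ {z} → P z → P z × StartsWith c z ⊎ P z × All (suc c ≤_) z
  cases pz with split pz
  ... | inj₁ s = inj₁ (pz , s)
  ... | inj₂ a = inj₂ (pz , a)

suc-C2 : ∀ l → suc l C 2 ≡ l C 2 + l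
suc-C2 l = begin
  suc l C 2       ≡⟨ nCk+nC[k+1]≡[n+1]C[k+1] l 1 ⟨
  l C 1 + l C 2   ≡⟨ cong (_+ l C 2) (nC1≡n l) ⟩
  l + l C 2       ≡⟨ +-comm l (l C 2) ⟩
  l C 2 + l       ∎
  where open ≡-Reasoning

sum-≥ : ∀ {d r z} → AllPairs (λ a b → d + a ≤ b) z → All (r ≤_) z →
        r * length z + d * (length z C 2) ≤ sum z
sum-≥ {d} {r} {[]} [] [] = ≤-reflexive (cong₂ _+_ (*-zeroʳ r) (*-zeroʳ d))
sum-≥ {d} {r} {x ∷ w} (x≪w ∷ ≪w) (r≤x ∷ _) = begin
  r * suc l + d * (suc l C 2)      ≡⟨ cong (λ c → r * suc l + d * c) (suc-C2 l) ⟩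
  r * suc l + d * (l C 2 + l)      ≡⟨ rearrange r l d (l C 2) ⟩
  r + ((d + r) * l + d * (l C 2))  ≤⟨ +-mono-≤ r≤x (+-monoˡ-≤ _ (*-monoˡ-≤ l (+-monoʳ-≤ d r≤x))) ⟩
  x + ((d + x) * l + d * (l C 2))  ≤⟨ +-monoʳ-≤ x (sum-≥ ≪w x≪w) ⟩
  x + sum w                        ∎
  where
  open ≤-Reasoning
  l = length w
  rearrange : ∀ r l d c → r * suc l + d * (c + l) ≡ r + ((d + r) * l + d * c)
  rearrange = solve-∀

-- Parts are listed in increasing order, so that the smallest part is the head; Defs lists them decreasingly.
record HatPartition (i m : ℕ) (z : List ℕ) : Set where
  field
    increasing : AllPairs _<_ z
    positive   : All (1 ≤_) z
    length≡    : length z ≡ i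
    sum≡       : sum z ≡ m
    large      : All (λ x → Even x → 2 * length (odds z) < x) z

odds-map-2+ : ∀ w → odds (map (2 +_) w) ≡ map (2 +_) (odds w)
odds-map-2+ [] = refl
odds-map-2+ (x ∷ w) with does (odd? x)
... | true  = cong (2 + x ∷_) (odds-map-2+ w)
... | false = odds-map-2+ w

module _ {w : List ℕ} where

  private
    length-odds : length (odds (1 ∷ map (2 +_) w)) ≡ suc (length (odds w))
    length-odds = cong suc (trans (cong length (odds-map-2+ w)) (length-map (2 +_) (odds w)))

    twice-odds : 2 * length (odds (1 ∷ map (2 +_) w)) ≡ 2 + 2 * length (odds w)
    twice-odds = trans (cong (2 *_) length-odds) (*-suc 2 (length (odds w)))

    sum-prepend : sum (1 ∷ map (2 +_) w) ≡ suc (2 * length w + sum w)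
    sum-prepend = cong suc (sum-map-+ 2 w)

  Hat-prepend1 : ∀ {j m₁} → HatPartition j m₁ w → HatPartition (suc j) (m₁ + suc (2 * j)) (1 ∷ map (2 +_) w)
  Hat-prepend1 {j} {m₁} h = record
    { increasing = All.map⁺ (All.tabulate λ _ → s≤s (s≤s z≤n))
                   ∷ AllPairs.map⁺ (AllPairs.map (λ a<b → s≤s (s≤s a<b)) increasing)
    ; positive   = s≤s z≤n ∷ All.map⁺ (All.tabulate λ _ → s≤s z≤n)
    ; length≡    = cong suc (trans (length-map (2 +_) w) length≡)
    ; sum≡       = begin
        sum (1 ∷ map (2 +_) w)     ≡⟨ sum-prepend ⟩
        suc (2 * length w + sum w) ≡⟨ cong₂ (λ l s → suc (2 * l + s)) length≡ sum≡ ⟩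
        suc (2 * j + m₁)           ≡⟨ +-comm (suc (2 * j)) m₁ ⟩
        m₁ + suc (2 * j)           ∎
    ; large      = (λ { (even ()) }) ∷ All.map⁺ (All.map shift large) }
    where
    open HatPartition h
    open ≡-Reasoning
    shift : ∀ {x} → (Even x → 2 * length (odds w) < x) →
            Even (2 + x) → 2 * length (odds (1 ∷ map (2 +_) w)) < 2 + x
    shift {x} large-x even-x = subst (_< 2 + x) (sym twice-odds) (s≤s (s≤s (large-x (even (Even.parity≡0ℙ even-x)))))

  Hat-prepend1⁻ : ∀ {j m₁} → HatPartition (suc j) (m₁ + suc (2 * j)) (1 ∷ map (2 +_) w) → HatPartition j m₁ w
  Hat-prepend1⁻ {j} {m₁} h = record
    { increasing = AllPairs.map (λ { (s≤s (s≤s a<b)) → a<b }) (AllPairs.map⁻ (AllPairs.tail increasing))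
    ; positive   = All.map nonzero (All.map⁻ (All.tail large))
    ; length≡    = length≡′
    ; sum≡       = +-cancelˡ-≡ (suc (2 * j)) _ _ (begin
        suc (2 * j + sum w)        ≡⟨ cong (λ l → suc (2 * l + sum w)) length≡′ ⟨
        suc (2 * length w + sum w) ≡⟨ sum-prepend ⟨
        sum (1 ∷ map (2 +_) w)     ≡⟨ sum≡ ⟩
        m₁ + suc (2 * j)           ≡⟨ +-comm m₁ (suc (2 * j)) ⟩
        suc (2 * j) + m₁           ∎)
    ; large      = All.map unshift (All.map⁻ (All.tail large)) }
    where
    open HatPartition h
    open ≡-Reasoning
    length≡′ : length w ≡ j
    length≡′ = suc-injective (trans (cong suc (sym (length-map (2 +_) w))) length≡)
    unshift : ∀ {x} → (Even (2 + x) → 2 * length (odds (1 ∷ map (2 +_) w)) < 2 + x) →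
              Even x → 2 * length (odds w) < x
    unshift {x} large-x even-x =
      ≤-pred (≤-pred (subst (_< 2 + x) twice-odds (large-x (even (Even.parity≡0ℙ even-x)))))
    -- A part 2 + 0 would be even without exceeding twice the number of odd parts, which is at least 1.
    nonzero : ∀ {x} → (Even (2 + x) → 2 * length (odds (1 ∷ map (2 +_) w)) < 2 + x) → 1 ≤ x
    nonzero {zero} large-x with subst (_< 2) twice-odds (large-x (even refl))
    ... | s≤s (s≤s ())
    nonzero {suc x} _ = s≤s z≤n

Card-Hat-startsWith1 : ∀ {j m₁ m c} → m ≡ m₁ + suc (2 * j) →
                       Card (HatPartition j m₁) c → Card (λ z → HatPartition (suc j) m z × StartsWith 1 z) c
Card-Hat-startsWith1 {j} {m₁} refl =
  Card-bijection prepend unprepend (λ h → Hat-prepend1 h , _ , refl) unprepend-sound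
                 (λ {w} _ → map-∸-+ 2 w) (λ { (h , _ , refl) → cong (1 ∷_) (map-+-∸ 2 (above h)) })
  where
  prepend unprepend : List ℕ → List ℕ
  prepend w = 1 ∷ map (2 +_) w
  unprepend z = map (_∸ 2) (drop 1 z)
  above : ∀ {v} → HatPartition (suc j) (m₁ + suc (2 * j)) (1 ∷ v) → All (2 ≤_) v
  above h = AllPairs.head (HatPartition.increasing h)
  unprepend-sound : ∀ {z} → HatPartition (suc j) (m₁ + suc (2 * j)) z × StartsWith 1 z →
                    HatPartition j m₁ (unprepend z)
  unprepend-sound (h , v , refl) =
    Hat-prepend1⁻ (subst (HatPartition (suc j) _) (cong (1 ∷_) (sym (map-+-∸ 2 (above h)))) h)

Hat-merge : ∀ {i m O E} → AllPairs _<_ O → AllPairs _<_ E → All Odd O → All Even E →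
            All (1 ≤_) O → All (2 * length O <_) E →
            length O + length E ≡ i → sum O + sum E ≡ m → HatPartition i m (merge _≤?_ O E)
Hat-merge {O = O} {E} <O <E odd-O even-E 1≤O large-E length≡ sum≡ = record
  { increasing = merge-odds-evens-increasing <O <E odd-O even-E
  ; positive   = All-merge 1≤O (All.map (≤-trans (s≤s z≤n)) large-E)
  ; length≡    = trans (length-merge O E) length≡
  ; sum≡       = trans (sum-merge O E) sum≡
  ; large      = subst (λ o → All (λ x → Even x → 2 * length o < x) (merge _≤?_ O E))
                       (sym (odds-merge odd-O even-E))
                       (All-merge (All.map (λ o e → ⊥-elim (odd⇒¬even o e)) odd-O)
                                  (All.map (λ lt _ → lt) large-E)) }

large-evens : ∀ {i m z} → HatPartition i m z → All (2 + 2 * length (odds z) ≤_) (evens z)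
large-evens {z = z} h =
  All.map (λ (even-e , lt) → even-> (length (odds z)) even-e lt)
          (All.zip (All.all-filter even? z , All-filter⁺ even? (HatPartition.large h)))

lowerWith raiseWith : ℕ → ℕ → List ℕ → List ℕ → List ℕ
lowerWith k a O E = merge _≤?_ (map (_∸ suc (2 * k)) E) (map (2 * a +_) (map (_∸ 1) O))
raiseWith k a O E = merge _≤?_ (map (1 +_) (map (_∸ 2 * k) E)) (map (suc (2 * a) +_) O)

lower raise : List ℕ → List ℕ
lower z = lowerWith (length (odds z)) (length (evens z)) (odds z) (evens z)
raise w = raiseWith (length (odds w)) (length (evens w)) (odds w) (evens w)

module Lowering {i m z} (h : HatPartition i m z) (2≤z : All (2 ≤_) z) where
  open HatPartition h
  open ≡-Reasoning

  O E O′ E′ O₁ : List ℕ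
  O = odds z
  E = evens z
  k a : ℕ
  k = length O
  a = length E
  O₁ = map (_∸ 1) O
  O′ = map (_∸ suc (2 * k)) E
  E′ = map (2 * a +_) O₁

  large-E : All (2 + 2 * k ≤_) E
  large-E = large-evens h

  2≤O : All (2 ≤_) O
  2≤O = All.filter⁺ odd? 2≤z

  1≤O : All (1 ≤_) O
  1≤O = All.map (≤-trans (s≤s z≤n)) 2≤O

  odd-O′ : All Odd O′
  odd-O′ = All.map⁺ (All.map odd-shifted (All.zip (All.all-filter even? z , large-E)))
    where
    odd-shifted : ∀ {e} → Even e × 2 + 2 * k ≤ e → Odd (e ∸ suc (2 * k))
    odd-shifted {e} (even-e , le) =
      odd-pred (subst Even (+-∸-assoc 1 (≤-trans (n≤1+n _) le))
                           (even-∸2* k (≤-trans (n≤1+n _) (≤-trans (n≤1+n _) le)) even-e))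

  even-E′ : All Even E′
  even-E′ = All.map⁺ (All.map⁺ (All.map even-shifted (All.zip (All.all-filter odd? z , 1≤O))))
    where
    even-shifted : ∀ {o} → Odd o × 1 ≤ o → Even (2 * a + (o ∸ 1))
    even-shifted {suc o} (odd-o , _) = even-2*+ a (even-pred odd-o)

  increasing-O′ : AllPairs _<_ O′
  increasing-O′ = map-increasing (λ le lt → ∸-monoˡ-< lt le)
                    (All.map (≤-trans (n≤1+n _)) large-E) (AllPairs-filter⁺ even? increasing)

  increasing-E′ : AllPairs _<_ E′
  increasing-E′ = AllPairs.map⁺ (AllPairs.map (+-monoʳ-< (2 * a))
                    (map-increasing (λ le lt → ∸-monoˡ-< lt le) 1≤O (AllPairs-filter⁺ odd? increasing)))

  1≤O′ : All (1 ≤_) O′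
  1≤O′ = All.map⁺ (All.map m<n⇒0<n∸m large-E)

  large-E′ : All (2 * length O′ <_) E′
  large-E′ = subst (λ l → All (2 * l <_) E′) (sym (length-map _ E))
               (All.map⁺ (All.map⁺ (All.map (λ 2≤o → m<m+n (2 * a) (m<n⇒0<n∸m 2≤o)) 2≤O)))

  length-O′E′ : length O′ + length E′ ≡ i
  length-O′E′ = begin
    length O′ + length E′ ≡⟨ cong₂ _+_ (length-map _ E) (trans (length-map _ O₁) (length-map _ O)) ⟩
    a + k                 ≡⟨ +-comm a k ⟩
    k + a                 ≡⟨ trans (length-odds-evens increasing) length≡ ⟩
    i                     ∎

  sum-O′E′ : ∀ {m₂} → m ≡ m₂ + i → sum O′ + sum E′ ≡ m₂
  sum-O′E′ {m₂} m≡ = +-cancelʳ-≡ i _ _ (begin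
    sum O′ + sum E′ + i
      ≡⟨ cong₂ (λ s l → sum O′ + s + l)
               (trans (sum-map-+ (2 * a) O₁) (cong (λ l → 2 * a * l + sum O₁) (length-map _ O)))
               (sym (trans (length-odds-evens increasing) length≡)) ⟩
    sum O′ + (2 * a * k + sum O₁) + (k + a)
      ≡⟨ rearrange (sum O′) a k (sum O₁) ⟩
    (1 * k + sum O₁) + (suc (2 * k) * a + sum O′)
      ≡⟨ cong₂ _+_ (sum-map-∸ 1 1≤O) (sum-map-∸ (suc (2 * k)) (All.map (≤-trans (n≤1+n _)) large-E)) ⟨
    sum O + sum E
      ≡⟨ trans (sum-odds-evens increasing) sum≡ ⟩
    m
      ≡⟨ m≡ ⟩
    m₂ + i ∎)
    where
    rearrange : ∀ s a k t → s + (2 * a * k + t) + (k + a) ≡ (1 * k + t) + (suc (2 * k) * a + s)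
    rearrange = solve-∀

  Hat-lower : ∀ {m₂} → m ≡ m₂ + i → HatPartition i m₂ (lower z)
  Hat-lower m≡ =
    Hat-merge increasing-O′ increasing-E′ odd-O′ even-E′ 1≤O′ large-E′ length-O′E′ (sum-O′E′ m≡)

  raise-lower : raise (lower z) ≡ z
  raise-lower = begin
    raise (lower z)
      ≡⟨ cong₂ (λ O E → raiseWith (length O) (length E) O E)
               (odds-merge odd-O′ even-E′) (evens-merge odd-O′ even-E′) ⟩
    raiseWith (length O′) (length E′) O′ E′
      ≡⟨ cong₂ (λ a k → raiseWith a k O′ E′) (length-map _ E) (trans (length-map _ O₁) (length-map _ O)) ⟩
    merge _≤?_ (map (1 +_) (map (_∸ 2 * a) E′)) (map (suc (2 * k) +_) O′)
      ≡⟨ cong₂ (merge _≤?_) (trans (cong (map (1 +_)) (map-∸-+ (2 * a) O₁)) (map-+-∸ 1 1≤O))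
                            (map-+-∸ (suc (2 * k)) (All.map (≤-trans (n≤1+n _)) large-E)) ⟩
    merge _≤?_ O E
      ≡⟨ merge-odds-evens increasing ⟩
    z ∎

module Raising {i m₂ w} (h : HatPartition i m₂ w) where
  open HatPartition h
  open ≡-Reasoning

  O E O″ E″ E₁ : List ℕ
  O = odds w
  E = evens w
  k a : ℕ
  k = length O
  a = length E
  E₁ = map (_∸ 2 * k) E
  O″ = map (1 +_) E₁
  E″ = map (suc (2 * a) +_) O

  large-E : All (2 + 2 * k ≤_) E
  large-E = large-evens h

  2k≤E : All (2 * k ≤_) E
  2k≤E = All.map (λ le → ≤-trans (n≤1+n _) (≤-trans (n≤1+n _) le)) large-E

  1≤O : All (1 ≤_) O
  1≤O = All.filter⁺ odd? positive

  odd-O″ : All Odd O″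
  odd-O″ = All.map⁺ (All.map⁺ (All.map (λ (even-e , le) → odd-suc (even-∸2* k le even-e))
                                        (All.zip (All.all-filter even? w , 2k≤E))))

  even-E″ : All Even E″
  even-E″ = All.map⁺ (All.map (λ odd-o → even-suc (odd-2*+ a odd-o)) (All.all-filter odd? w))

  increasing-O″ : AllPairs _<_ O″
  increasing-O″ = AllPairs.map⁺ (AllPairs.map s≤s
                    (map-increasing (λ le lt → ∸-monoˡ-< lt le) 2k≤E (AllPairs-filter⁺ even? increasing)))

  increasing-E″ : AllPairs _<_ E″
  increasing-E″ = AllPairs.map⁺ (AllPairs.map (+-monoʳ-< (suc (2 * a))) (AllPairs-filter⁺ odd? increasing))

  1≤O″ : All (1 ≤_) O″
  1≤O″ = All.map⁺ (All.tabulate λ _ → s≤s z≤n)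

  large-E″ : All (2 * length O″ <_) E″
  large-E″ = subst (λ l → All (2 * l <_) E″) (sym (trans (length-map _ E₁) (length-map _ E)))
               (All.map⁺ (All.tabulate λ {o} _ → s≤s (m≤m+n (2 * a) o)))

  length-O″E″ : length O″ + length E″ ≡ i
  length-O″E″ = begin
    length O″ + length E″ ≡⟨ cong₂ _+_ (trans (length-map _ E₁) (length-map _ E)) (length-map _ O) ⟩
    a + k                 ≡⟨ +-comm a k ⟩
    k + a                 ≡⟨ trans (length-odds-evens increasing) length≡ ⟩
    i                     ∎

  sum-O″E″ : ∀ {m} → m ≡ m₂ + i → sum O″ + sum E″ ≡ m
  sum-O″E″ {m} m≡ = begin
    sum O″ + sum E″
      ≡⟨ cong₂ _+_ (trans (sum-map-+ 1 E₁) (cong (λ l → 1 * l + sum E₁) (length-map _ E)))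
                   (sum-map-+ (suc (2 * a)) O) ⟩
    (1 * a + sum E₁) + (suc (2 * a) * k + sum O)
      ≡⟨ rearrange a (sum E₁) k (sum O) ⟩
    (sum O + (2 * k * a + sum E₁)) + (k + a)
      ≡⟨ cong₂ (λ s l → sum O + s + l) (sym (sum-map-∸ (2 * k) 2k≤E))
               (trans (length-odds-evens increasing) length≡) ⟩
    sum O + sum E + i
      ≡⟨ cong (_+ i) (trans (sum-odds-evens increasing) sum≡) ⟩
    m₂ + i
      ≡⟨ m≡ ⟨
    m ∎
    where
    rearrange : ∀ a t k s → (1 * a + t) + (suc (2 * a) * k + s) ≡ (s + (2 * k * a + t)) + (k + a)
    rearrange = solve-∀

  Hat-raise : ∀ {m} → m ≡ m₂ + i → HatPartition i m (raise w)
  Hat-raise m≡ =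
    Hat-merge increasing-O″ increasing-E″ odd-O″ even-E″ 1≤O″ large-E″ length-O″E″ (sum-O″E″ m≡)

  2≤raise : All (2 ≤_) (raise w)
  2≤raise =
    All-merge (All.map⁺ (All.map⁺ (All.map (λ le → s≤s (m<n⇒0<n∸m (≤-trans (n≤1+n _) le))) large-E)))
              (All.map⁺ (All.map (λ 1≤o → s≤s (≤-trans 1≤o (m≤n+m _ (2 * a)))) 1≤O))

  lower-raise : lower (raise w) ≡ w
  lower-raise = begin
    lower (raise w)
      ≡⟨ cong₂ (λ O E → lowerWith (length O) (length E) O E)
               (odds-merge odd-O″ even-E″) (evens-merge odd-O″ even-E″) ⟩
    lowerWith (length O″) (length E″) O″ E″
      ≡⟨ cong₂ (λ a k → lowerWith a k O″ E″) (trans (length-map _ E₁) (length-map _ E)) (length-map _ O) ⟩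
    merge _≤?_ (map (_∸ suc (2 * a)) E″) (map (2 * k +_) (map (_∸ 1) O″))
      ≡⟨ cong₂ (merge _≤?_) (map-∸-+ (suc (2 * a)) O)
                            (trans (cong (map (2 * k +_)) (map-∸-+ 1 E₁)) (map-+-∸ (2 * k) 2k≤E)) ⟩
    merge _≤?_ O E
      ≡⟨ merge-odds-evens increasing ⟩
    w ∎

Card-Hat-atLeast2 : ∀ {i m₂ m c} → m ≡ m₂ + i →
                    Card (HatPartition i m₂) c → Card (λ z → HatPartition i m z × All (2 ≤_) z) c
Card-Hat-atLeast2 m≡ =
  Card-bijection raise lower (λ h → Raising.Hat-raise h m≡ , Raising.2≤raise h)
                 (λ (h , 2≤z) → Lowering.Hat-lower h 2≤z m≡)
                 Raising.lower-raise (λ (h , 2≤z) → Lowering.raise-lower h 2≤z)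

Hat-split : ∀ {i m z} → HatPartition i m z → StartsWith 1 z ⊎ All (2 ≤_) z
Hat-split {z = []}    _ = inj₂ []
Hat-split {z = x ∷ w} h =
  StartsWith-split (All.head (HatPartition.positive h)) (All.map <⇒≤ (AllPairs.head (HatPartition.increasing h)))

Hat-sum-≥ : ∀ {i m z} → HatPartition i m z → i + i C 2 ≤ m
Hat-sum-≥ {z = z} h = subst₂ (λ i m → i + i C 2 ≤ m) length≡ sum≡
  (subst (_≤ sum z) (cong₂ _+_ (*-identityˡ (length z)) (*-identityˡ (length z C 2))) (sum-≥ increasing positive))
  where open HatPartition h

record DistantPartition (d r i n : ℕ) (z : List ℕ) : Set where
  field
    distant : AllPairs (λ a b → d + a ≤ b) z
    bounded : All (r ≤_) z
    length≡ : length z ≡ i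
    sum≡    : sum z ≡ n

Distant-sum-≥ : ∀ {d r i n z} → DistantPartition d r i n z → r * i + d * (i C 2) ≤ n
Distant-sum-≥ {d} {r} h = subst₂ (λ i n → r * i + d * (i C 2) ≤ n) length≡ sum≡ (sum-≥ distant bounded)
  where open DistantPartition h

module _ {d r : ℕ} {w : List ℕ} where

  private
    sum-prepend : sum (r ∷ map (d +_) w) ≡ sum w + (r + d * length w)
    sum-prepend = trans (cong (r +_) (sum-map-+ d w)) (rearrange r (d * length w) (sum w))
      where
      rearrange : ∀ a b c → a + (b + c) ≡ c + (a + b)
      rearrange = solve-∀

  Distant-prepend : ∀ {j n} → DistantPartition d r j n w →
                    DistantPartition d r (suc j) (n + (r + d * j)) (r ∷ map (d +_) w)
  Distant-prepend {j} h = record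
    { distant = All.map⁺ (All.map (+-monoʳ-≤ d) bounded)
                ∷ AllPairs.map⁺ (AllPairs.map (+-monoʳ-≤ d) distant)
    ; bounded = ≤-refl ∷ All.map⁺ (All.map (λ {x} r≤x → ≤-trans r≤x (m≤n+m x d)) bounded)
    ; length≡ = cong suc (trans (length-map (d +_) w) length≡)
    ; sum≡    = trans sum-prepend (cong₂ (λ s l → s + (r + d * l)) sum≡ length≡) }
    where open DistantPartition h

  Distant-prepend⁻ : ∀ {j n} → DistantPartition d r (suc j) (n + (r + d * j)) (r ∷ map (d +_) w) →
                     DistantPartition d r j n w
  Distant-prepend⁻ {j} {n} h = record
    { distant = AllPairs.map (+-cancelˡ-≤ d _ _) (AllPairs.map⁻ (AllPairs.tail distant))
    ; bounded = All.map (+-cancelˡ-≤ d _ _) (All.map⁻ (AllPairs.head distant))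
    ; length≡ = length≡′
    ; sum≡    = +-cancelʳ-≡ (r + d * j) _ _
                  (trans (cong (λ l → sum w + (r + d * l)) (sym length≡′)) (trans (sym sum-prepend) sum≡)) }
    where
    open DistantPartition h
    length≡′ : length w ≡ j
    length≡′ = suc-injective (trans (cong suc (sym (length-map (d +_) w))) length≡)

Card-Distant-startsWith : ∀ {d r j n₁ n c} → n ≡ n₁ + (r + d * j) →
                          Card (DistantPartition d r j n₁) c →
                          Card (λ z → DistantPartition d r (suc j) n z × StartsWith r z) c
Card-Distant-startsWith {d} {r} {j} {n₁} refl =
  Card-bijection prepend unprepend (λ h → Distant-prepend h , _ , refl) unprepend-sound
                 (λ {w} _ → map-∸-+ d w) (λ { (h , _ , refl) → cong (r ∷_) (map-+-∸ d (above h)) })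
  where
  prepend unprepend : List ℕ → List ℕ
  prepend w = r ∷ map (d +_) w
  unprepend z = map (_∸ d) (drop 1 z)
  above : ∀ {v} → DistantPartition d r (suc j) (n₁ + (r + d * j)) (r ∷ v) → All (d ≤_) v
  above h = All.map (≤-trans (m≤m+n d r)) (AllPairs.head (DistantPartition.distant h))
  unprepend-sound : ∀ {z} → DistantPartition d r (suc j) (n₁ + (r + d * j)) z × StartsWith r z →
                    DistantPartition d r j n₁ (unprepend z)
  unprepend-sound (h , v , refl) =
    Distant-prepend⁻ (subst (DistantPartition d r (suc j) _) (cong (r ∷_) (sym (map-+-∸ d (above h)))) h)

module _ {d r i : ℕ} {w : List ℕ} where

  private
    sum-map-suc : sum (map suc w) ≡ sum w + length w
    sum-map-suc = trans (sum-map-+ 1 w) (trans (cong (_+ sum w) (*-identityˡ (length w))) (+-comm (length w) (sum w)))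

  Distant-map-suc : ∀ {n} → DistantPartition d r i n w → DistantPartition d r i (n + i) (map suc w)
  Distant-map-suc h = record
    { distant = AllPairs.map⁺ (AllPairs.map (λ {a} {b} le → subst (_≤ suc b) (sym (+-suc d a)) (s≤s le)) distant)
    ; bounded = All.map⁺ (All.map m≤n⇒m≤1+n bounded)
    ; length≡ = trans (length-map suc w) length≡
    ; sum≡    = trans sum-map-suc (cong₂ _+_ sum≡ length≡) }
    where open DistantPartition h

  Distant-map-suc⁻ : ∀ {n} → DistantPartition d r i (n + i) (map suc w) → All (suc r ≤_) (map suc w) →
                     DistantPartition d r i n w
  Distant-map-suc⁻ h r<w = record
    { distant = AllPairs.map (λ {a} {b} le → ≤-pred (subst (_≤ suc b) (+-suc d a) le)) (AllPairs.map⁻ distant)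
    ; bounded = All.map ≤-pred (All.map⁻ r<w)
    ; length≡ = length≡′
    ; sum≡    = +-cancelʳ-≡ i _ _ (trans (cong (sum w +_) (sym length≡′)) (trans (sym sum-map-suc) sum≡)) }
    where
    open DistantPartition h
    length≡′ : length w ≡ i
    length≡′ = trans (sym (length-map suc w)) length≡

Card-Distant-atLeast : ∀ {d r i n₂ n c} → n ≡ n₂ + i →
                       Card (DistantPartition d r i n₂) c →
                       Card (λ z → DistantPartition d r i n z × All (suc r ≤_) z) c
Card-Distant-atLeast {d} {r} {i} {n₂} refl =
  Card-bijection (map suc) (map (_∸ 1))
                 (λ h → Distant-map-suc h , All.map⁺ (All.map s≤s (DistantPartition.bounded h)))
                 (λ (h , r<z) → Distant-map-suc⁻ (subst (DistantPartition d r i _) (sym (shift r<z)) h)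
                                                 (subst (All (suc r ≤_)) (sym (shift r<z)) r<z))
                 (λ {w} _ → map-∸-+ 1 w) (λ (_ , r<z) → shift r<z)
  where
  shift : ∀ {z} → All (suc r ≤_) z → map suc (map (_∸ 1) z) ≡ z
  shift r<z = map-+-∸ 1 (All.map (≤-trans (s≤s z≤n)) r<z)

Distant-split : ∀ {d r i n z} → DistantPartition d r i n z → StartsWith r z ⊎ All (suc r ≤_) z
Distant-split {z = []}    _ = inj₂ []
Distant-split {d} {z = x ∷ w} h =
  StartsWith-split (All.head (DistantPartition.bounded h))
                   (All.map (≤-trans (m≤n+m x d)) (AllPairs.head (DistantPartition.distant h)))

2j+1≤ : ∀ j → suc (2 * j) ≤ suc j + suc j C 2
2j+1≤ j = begin
  suc (2 * j)                ≤⟨ m≤m+n (suc (2 * j)) (j C 2) ⟩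
  suc (2 * j) + j C 2        ≡⟨ rearrange j (j C 2) ⟩
  suc j + (j C 2 + j)        ≡⟨ cong (suc j +_) (suc-C2 j) ⟨
  suc j + suc j C 2          ∎
  where
  open ≤-Reasoning
  rearrange : ∀ j c → suc (2 * j) + c ≡ suc j + (c + j)
  rearrange = solve-∀

m+n+o≡m+o+n : ∀ m n o → m + n + o ≡ m + o + n
m+n+o≡m+o+n = solve-∀

≡+suc⇒< : ∀ {m k c} → m ≡ k + suc c → k < m
≡+suc⇒< {k = k} refl = m<m+n k (s≤s z≤n)

module _ (e s : ℕ) where

  -- With s = r − 1 and e = d − 2, the i-th summand of the theorem is p̂ᵢ(n − offset i).
  offset : ℕ → ℕ
  offset i = s * i + e * (i C 2)

  private
    d r : ℕ
    d = 2 + e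
    r = suc s

    offset-0 : offset 0 ≡ 0
    offset-0 = cong₂ _+_ (*-zeroʳ s) (*-zeroʳ e)

    offset-suc : ∀ m j → m + suc (2 * j) + offset (suc j) ≡ (m + offset j) + (r + d * j)
    offset-suc m j = begin
      m + suc (2 * j) + (s * suc j + e * (suc j C 2))
        ≡⟨ cong (λ c → m + suc (2 * j) + (s * suc j + e * c)) (suc-C2 j) ⟩
      m + suc (2 * j) + (s * suc j + e * (j C 2 + j))
        ≡⟨ rearrange m j s e (j C 2) ⟩
      (m + offset j) + (r + d * j) ∎
      where
      open ≡-Reasoning
      rearrange : ∀ m j s e c → m + suc (2 * j) + (s * suc j + e * (c + j))
                              ≡ m + (s * j + e * c) + (suc s + (2 + e) * j)
      rearrange = solve-∀

    Distant-excess-≥ : ∀ {i m z} → DistantPartition d r i (m + offset i) z → i + 2 * (i C 2) ≤ m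
    Distant-excess-≥ {i} {m} h = +-cancelʳ-≤ (offset i) _ _
      (subst (_≤ m + offset i) (rearrange s e i (i C 2)) (Distant-sum-≥ h))
      where
      rearrange : ∀ s e i c → suc s * i + (2 + e) * c ≡ i + 2 * c + (s * i + e * c)
      rearrange = solve-∀

    base : ∀ m → Equinumerous (HatPartition 0 m) (DistantPartition d r 0 (m + offset 0))
    base zero = 1 , Card-singleton [] hat-[] only-[] , Card-singleton [] distant-[] only-[]′
      where
      hat-[] : HatPartition 0 0 []
      hat-[] = record { increasing = [] ; positive = [] ; length≡ = refl ; sum≡ = refl ; large = [] }
      distant-[] : DistantPartition d r 0 (0 + offset 0) []
      distant-[] = record { distant = [] ; bounded = [] ; length≡ = refl ; sum≡ = sym offset-0 }
      only-[] : ∀ {z} → HatPartition 0 0 z → z ≡ []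
      only-[] {[]} _ = refl
      only-[]′ : ∀ {z} → DistantPartition d r 0 (0 + offset 0) z → z ≡ []
      only-[]′ {[]} _ = refl
    base (suc m) = 0 , Card-∅ no-hat , Card-∅ no-distant
      where
      no-hat : ∀ {z} → ¬ HatPartition 0 (suc m) z
      no-hat {[]} h with HatPartition.sum≡ h
      ... | ()
      no-distant : ∀ {z} → ¬ DistantPartition d r 0 (suc m + offset 0) z
      no-distant {[]} h with trans (DistantPartition.sum≡ h) (cong (suc m +_) offset-0)
      ... | ()

    Claim : ℕ → Set
    Claim m = ∀ i → Equinumerous (HatPartition i m) (DistantPartition d r i (m + offset i))

    step : ∀ m → (∀ {m′} → m′ < m → Claim m′) → Claim m
    step m _   zero    = base m
    step m rec (suc j) with suc (2 * j) ≤? m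
    ... | no  m≱2j+1 = 0 , Card-∅ no-hat , Card-∅ no-distant
      where
      no-hat : ∀ {z} → ¬ HatPartition (suc j) m z
      no-hat h = m≱2j+1 (≤-trans (2j+1≤ j) (Hat-sum-≥ h))
      no-distant : ∀ {z} → ¬ DistantPartition d r (suc j) (m + offset (suc j)) z
      no-distant h = m≱2j+1 (≤-trans (2j+1≤ j) (≤-trans (+-monoʳ-≤ (suc j) (m≤m+n _ _)) (Distant-excess-≥ h)))
    ... | yes 2j+1≤m = combine (rec (≡+suc⇒< m≡₁) j) (rec (≡+suc⇒< m≡₂) (suc j))
      where
      m₁ m₂ : ℕ
      m₁ = m ∸ suc (2 * j)
      m₂ = m ∸ suc j
      m≡₁ : m ≡ m₁ + suc (2 * j)
      m≡₁ = sym (m∸n+n≡m 2j+1≤m)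
      m≡₂ : m ≡ m₂ + suc j
      m≡₂ = sym (m∸n+n≡m (≤-trans (s≤s (m≤m+n j _)) 2j+1≤m))
      combine : Equinumerous (HatPartition j m₁) (DistantPartition d r j (m₁ + offset j)) →
                Equinumerous (HatPartition (suc j) m₂) (DistantPartition d r (suc j) (m₂ + offset (suc j))) →
                Equinumerous (HatPartition (suc j) m) (DistantPartition d r (suc j) (m + offset (suc j)))
      combine (c₁ , H₁ , D₁) (c₂ , H₂ , D₂) =
        c₁ + c₂ , Card-split Hat-split (Card-Hat-startsWith1 m≡₁ H₁) (Card-Hat-atLeast2 m≡₂ H₂)
                , Card-split Distant-split
                    (Card-Distant-startsWith (trans (cong (_+ offset (suc j)) m≡₁) (offset-suc m₁ j)) D₁)
                    (Card-Distant-atLeast (trans (cong (_+ offset (suc j)) m≡₂) (m+n+o≡m+o+n m₂ (suc j) _)) D₂)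

  Hat≈Distant : ∀ m i → Equinumerous (HatPartition i m) (DistantPartition (2 + e) (suc s) i (m + offset i))
  Hat≈Distant = <-rec Claim step

candidates-unique : ∀ n l → Unique (candidates n l)
candidates-unique n zero    = [] ∷ []
candidates-unique n (suc l) =
  All.tabulate nonempty
  ∷ Unique.concat⁺ (All.map⁺ (All.tabulate λ _ → Unique.map⁺ ∷-injectiveʳ (candidates-unique n l)))
                   (AllPairs.map⁺ (AllPairs.map disjoint (Unique.map⁺ suc-injective (Unique.upTo⁺ n))))
  where
  extend : ℕ → List (List ℕ)
  extend x = map (x ∷_) (candidates n l)
  nonempty : ∀ {w} → w ∈ concatMap extend (map suc (upTo n)) → [] ≢ w
  nonempty w∈ with Any.satisfied (∈-concatMap⁻ extend {xs = map suc (upTo n)} w∈)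
  ... | x , w∈x with ∈-map⁻ (x ∷_) w∈x
  ... | _ , _ , refl = λ ()
  disjoint : ∀ {x y} → x ≢ y → Disjoint (extend x) (extend y)
  disjoint x≢y (v∈x , v∈y) with ∈-map⁻ _ v∈x | ∈-map⁻ _ v∈y
  ... | _ , _ , refl | _ , _ , eq = x≢y (∷-injectiveˡ eq)

∈-candidates : ∀ {n} l {z} → length z ≤ l → All (λ x → 1 ≤ x × x ≤ n) z → z ∈ candidates n l
∈-candidates zero    {[]}        _          _                  = here refl
∈-candidates (suc l) {[]}        _          _                  = here refl
∈-candidates {n} (suc l) {suc y ∷ z} (s≤s |z|≤l) ((_ , y<n) ∷ bounds) =
  there (∈-concatMap⁺ (λ x → map (x ∷_) (candidates n l))
                      (Any.map (λ { refl → ∈-map⁺ (suc y ∷_) (∈-candidates l |z|≤l bounds) })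
                               (∈-map⁺ suc (∈-upTo⁺ y<n))))

parts≤sum : ∀ z → All (_≤ sum z) z
parts≤sum []      = []
parts≤sum (x ∷ z) = m≤m+n x (sum z) ∷ All.map (λ le → ≤-trans le (m≤n+m (sum z) x)) (parts≤sum z)

length≤sum : ∀ {z} → All (1 ≤_) z → length z ≤ sum z
length≤sum []           = z≤n
length≤sum (1≤x ∷ 1≤z) = +-mono-≤ 1≤x (length≤sum 1≤z)

∈-partitions⁺ : ∀ {n z} → IsPartitionOf n z → z ∈ partitions n
∈-partitions⁺ {n} {z} p@(1≤z , _ , refl) =
  ∈-filter⁺ (isPartitionOf? n) (∈-candidates n (length≤sum 1≤z) (All.zip (1≤z , parts≤sum z))) p

∈-partitions⁻ : ∀ {n z} → z ∈ partitions n → IsPartitionOf n z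
∈-partitions⁻ {n} z∈ = proj₂ (∈-filter⁻ (isPartitionOf? n) {xs = candidates n n} z∈)

partitions-unique : ∀ n → Unique (partitions n)
partitions-unique n = Unique.filter⁺ (isPartitionOf? n) (candidates-unique n n)

module _ {A : Set} where

  All-reverse : ∀ {P : A → Set} {xs} → All P xs → All P (reverse xs)
  All-reverse {xs = xs} = All-resp-↭ (↭-sym (↭-reverse xs))

  AllPairs-reverse : ∀ {R : A → A → Set} {xs} → AllPairs R xs → AllPairs (flip R) (reverse xs)
  AllPairs-reverse []                         = []
  AllPairs-reverse {xs = x ∷ xs} (x≪xs ∷ ≪xs) = subst (AllPairs _) (sym (unfold-reverse x xs))
    (AllPairs.++⁺ (AllPairs-reverse ≪xs) ([] ∷ []) (All.map (_∷ []) (All-reverse x≪xs)))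

lo≡length-odds : ∀ z → lo z ≡ length (odds z)
lo≡length-odds z =
  cong length (filter-≐ (λ x → ¬? (2 ∣? x)) odd? (¬∣⇒odd , λ o d → odd⇒¬even o (∣⇒even d)) z)
  where
  ¬∣⇒odd : ∀ {x} → ¬ 2 ∣ x → Odd x
  ¬∣⇒odd {x} ¬2∣x with odd? x
  ... | yes o  = o
  ... | no  ¬o = ⊥-elim (¬2∣x (even⇒∣ (¬odd⇒even ¬o)))

lo-reverse : ∀ z → lo (reverse z) ≡ lo z
lo-reverse z = ↭-length (filter-↭ (λ x → ¬? (2 ∣? x)) (↭-reverse z))

sum-reverse : ∀ z → sum (reverse z) ≡ sum z
sum-reverse z = sum-↭ (↭-reverse z)

Card-HatPartition : ∀ i m → Card (HatPartition i m) (phatℕ i m)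
Card-HatPartition i m = Card-bijection reverse reverse to-hat from-hat
                 (λ {μ} _ → reverse-involutive μ) (λ {z} _ → reverse-involutive z)
                 (Card-filter _ (partitions m) (partitions-unique m))
  where
  to-hat : ∀ {μ} → μ ∈ partitions m × (Distant 1 μ × length μ ≡ i × EvenCond μ) →
           HatPartition i m (reverse μ)
  to-hat {μ} (μ∈ , decreasing , length≡ , even-cond) with ∈-partitions⁻ μ∈
  ... | positive , _ , sum≡ = record
    { increasing = AllPairs-reverse (Linked.Linked⇒AllPairs (λ y<x z<y → <-trans z<y y<x) decreasing)
    ; positive   = All-reverse positive
    ; length≡    = trans (length-reverse μ) length≡
    ; sum≡       = trans (sum-reverse μ) sum≡
    ; large      = All-reverse (All.map (λ large-x even-x → subst (λ k → 2 * k < _) lo-μ (large-x (even⇒∣ even-x)))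
                                        even-cond) }
    where
    lo-μ : lo μ ≡ length (odds (reverse μ))
    lo-μ = trans (sym (lo-reverse μ)) (lo≡length-odds (reverse μ))
  from-hat : ∀ {z} → HatPartition i m z →
             reverse z ∈ partitions m × (Distant 1 (reverse z) × length (reverse z) ≡ i × EvenCond (reverse z))
  from-hat {z} h =
    ∈-partitions⁺ (All-reverse positive
                  , Linked.AllPairs⇒Linked (AllPairs-reverse (AllPairs.map <⇒≤ increasing))
                  , trans (sum-reverse z) sum≡)
    , Linked.AllPairs⇒Linked (AllPairs-reverse increasing)
    , trans (length-reverse z) length≡
    , All-reverse (All.map (λ large-x 2∣x → subst (λ k → 2 * k < _) lo-z (large-x (∣⇒even 2∣x))) large)
    where
    open HatPartition h
    lo-z : length (odds z) ≡ lo (reverse z)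
    lo-z = sym (trans (lo-reverse z) (lo≡length-odds z))

distantAbove? : ∀ d r μ → Dec (Distant d μ × SmallestAtLeast r μ)
distantAbove? d r μ = distant? d μ ×-dec smallestAtLeast? r μ

distantPartitions : ℕ → ℕ → ℕ → List (List ℕ)
distantPartitions d r n = filter (distantAbove? d r) (partitions n)

Card-DistantPartition : ∀ {d r} i n → 1 ≤ r →
               Card (DistantPartition d r i n) (length (filter (λ μ → length μ ≟ i) (distantPartitions d r n)))
Card-DistantPartition {d} {r} i n 1≤r =
  Card-bijection reverse reverse to-distant from-distant
    (λ {μ} _ → reverse-involutive μ) (λ {z} _ → reverse-involutive z)
    (Card-filter _ (distantPartitions d r n) (Unique.filter⁺ _ (partitions-unique n)))
  where
  to-distant : ∀ {μ} → μ ∈ distantPartitions d r n × length μ ≡ i → DistantPartition d r i n (reverse μ)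
  to-distant {μ} (μ∈ , length≡) with ∈-filter⁻ (distantAbove? d r) {xs = partitions n} μ∈
  ... | μ∈′ , separated , r≤μ = record
    { distant = AllPairs-reverse
                  (Linked.Linked⇒AllPairs (λ {x} {y} y≪x z≪y → ≤-trans z≪y (≤-trans (m≤n+m y d) y≪x)) separated)
    ; bounded = All-reverse r≤μ
    ; length≡ = trans (length-reverse μ) length≡
    ; sum≡    = trans (sum-reverse μ) (proj₂ (proj₂ (∈-partitions⁻ μ∈′))) }
  from-distant : ∀ {z} → DistantPartition d r i n z → reverse z ∈ distantPartitions d r n × length (reverse z) ≡ i
  from-distant {z} h =
    ∈-filter⁺ (distantAbove? d r)
      (∈-partitions⁺ (All-reverse (All.map (≤-trans 1≤r) bounded)
                     , Linked.AllPairs⇒Linked (AllPairs-reverse (AllPairs.map (≤-trans (m≤n+m _ d)) distant))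
                     , trans (sum-reverse z) sum≡))
      (Linked.AllPairs⇒Linked (AllPairs-reverse distant) , All-reverse bounded)
    , trans (length-reverse z) length≡
    where open DistantPartition h

open import Data.Integer as ℤ using (ℤ; +_; _⊖_)
import Data.Integer.Properties as ℤ

module _ {A : Set} (key : A → ℕ) where

  count : ℕ → List A → ℕ
  count i xs = length (filter (λ x → key x ≟ i) xs)

  length-filter-≤-suc : ∀ M xs → length (filter (λ x → key x ≤? suc M) xs)
                                 ≡ length (filter (λ x → key x ≤? M) xs) + count (suc M) xs
  length-filter-≤-suc M []       = refl
  length-filter-≤-suc M (x ∷ xs) with <-cmp (key x) (suc M) | length-filter-≤-suc M xs
  ... | tri< x<1+M x≢1+M _ | ih = begin
    length (filter (λ x → key x ≤? suc M) (x ∷ xs))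
      ≡⟨ cong length (filter-accept (λ x → key x ≤? suc M) (<⇒≤ x<1+M)) ⟩
    suc (length (filter (λ x → key x ≤? suc M) xs))
      ≡⟨ cong suc ih ⟩
    suc (length (filter (λ x → key x ≤? M) xs) + count (suc M) xs)
      ≡⟨ cong₂ (λ a b → length a + length b) (filter-accept (λ x → key x ≤? M) (≤-pred x<1+M))
                                            (filter-reject (λ x → key x ≟ suc M) x≢1+M) ⟨
    length (filter (λ x → key x ≤? M) (x ∷ xs)) + count (suc M) (x ∷ xs) ∎
    where open ≡-Reasoning
  ... | tri≈ _ x≡1+M _ | ih = begin
    length (filter (λ x → key x ≤? suc M) (x ∷ xs))
      ≡⟨ cong length (filter-accept (λ x → key x ≤? suc M) (≤-reflexive x≡1+M)) ⟩
    suc (length (filter (λ x → key x ≤? suc M) xs))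
      ≡⟨ cong suc ih ⟩
    suc (length (filter (λ x → key x ≤? M) xs) + count (suc M) xs)
      ≡⟨ +-suc _ _ ⟨
    length (filter (λ x → key x ≤? M) xs) + suc (count (suc M) xs)
      ≡⟨ cong₂ (λ a b → length a + length b)
               (filter-reject (λ x → key x ≤? M) (λ x≤M → 1+n≰n (subst (_≤ M) x≡1+M x≤M)))
               (filter-accept (λ x → key x ≟ suc M) x≡1+M) ⟨
    length (filter (λ x → key x ≤? M) (x ∷ xs)) + count (suc M) (x ∷ xs) ∎
    where open ≡-Reasoning
  ... | tri> _ x≢1+M 1+M<x | ih = begin
    length (filter (λ x → key x ≤? suc M) (x ∷ xs))
      ≡⟨ cong length (filter-reject (λ x → key x ≤? suc M) (<⇒≱ 1+M<x)) ⟩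
    length (filter (λ x → key x ≤? suc M) xs)
      ≡⟨ ih ⟩
    length (filter (λ x → key x ≤? M) xs) + count (suc M) xs
      ≡⟨ cong₂ (λ a b → length a + length b)
               (filter-reject (λ x → key x ≤? M) (<⇒≱ (<-trans (n<1+n M) 1+M<x)))
               (filter-reject (λ x → key x ≟ suc M) x≢1+M) ⟨
    length (filter (λ x → key x ≤? M) (x ∷ xs)) + count (suc M) (x ∷ xs) ∎
    where open ≡-Reasoning

  length≡sum-counts : ∀ M xs → All (λ x → 1 ≤ key x × key x ≤ M) xs →
                      + length xs ≡ sumFrom1 M (λ i → + count i xs)
  length≡sum-counts M xs bounds =
    trans (cong (+_ ∘ length) (sym (filter-all (λ x → key x ≤? M) (All.map proj₂ bounds))))
          (up-to M)
    where
    open import Function using (_∘_)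
    up-to : ∀ M′ → + length (filter (λ x → key x ≤? M′) xs) ≡ sumFrom1 M′ (λ i → + count i xs)
    up-to zero     = cong (+_ ∘ length)
                       (filter-none (λ x → key x ≤? 0) (All.map (λ (1≤x , _) x≤0 → 1+n≰n (≤-trans 1≤x x≤0)) bounds))
    up-to (suc M′) = trans (cong +_ (length-filter-≤-suc M′ xs)) (cong (ℤ._+ + count (suc M′) xs) (up-to M′))

sumFrom1-cong : ∀ M {f g : ℕ → ℤ} → (∀ k → f (suc k) ≡ g (suc k)) → sumFrom1 M f ≡ sumFrom1 M g
sumFrom1-cong zero    _   = refl
sumFrom1-cong (suc M) f≗g = cong₂ ℤ._+_ (sumFrom1-cong M f≗g) (f≗g M)

[+m]-[+a]-[+b] : ∀ m a b → + m ℤ.- + a ℤ.- + b ≡ m ⊖ (a + b)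
[+m]-[+a]-[+b] m a b = begin
  + m ℤ.- + a ℤ.- + b        ≡⟨ ℤ.+-assoc (+ m) (ℤ.- + a) (ℤ.- + b) ⟩
  + m ℤ.+ (ℤ.- + a ℤ.- + b)  ≡⟨ cong (λ x → + m ℤ.+ x) (ℤ.neg-distrib-+ (+ a) (+ b)) ⟨
  + m ℤ.- + (a + b)          ≡⟨ ℤ.m-n≡m⊖n m (a + b) ⟩
  m ⊖ (a + b)                ∎
  where open ≡-Reasoning

module _ (e s n : ℕ) where

  distantCount : ℕ → ℕ
  distantCount i = count length i (distantPartitions (2 + e) (suc s) n)

  private
    phat-suc : ∀ k m → phat (suc k) (+ m) ≡ + phatℕ (suc k) m
    phat-suc k zero    = refl
    phat-suc k (suc m) = refl

    phat-neg : ∀ i t → 1 ≤ t → phat i (ℤ.- (+ t)) ≡ + 0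
    phat-neg i (suc t) _ = refl

  phat≡count : ∀ k → phat (suc k) (+ n ℤ.- + (s * suc k) ℤ.- + (e * (suc k C 2))) ≡ + distantCount (suc k)
  phat≡count k = trans (cong (phat i) ([+m]-[+a]-[+b] n (s * i) (e * (i C 2)))) (by-cases (o ≤? n))
    where
    open ≡-Reasoning
    i o : ℕ
    i = suc k
    o = offset e s i
    by-cases : Dec (o ≤ n) → phat i (n ⊖ o) ≡ + distantCount i
    by-cases (yes o≤n) with Hat≈Distant e s (n ∸ o) i
    ... | c , hats , distants = begin
      phat i (n ⊖ o)      ≡⟨ cong (phat i) (ℤ.⊖-≥ o≤n) ⟩
      phat i (+ (n ∸ o))  ≡⟨ phat-suc k (n ∸ o) ⟩
      + phatℕ i (n ∸ o)   ≡⟨ cong +_ (Card-unique (Card-HatPartition i (n ∸ o)) hats id id) ⟩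
      + c                 ≡⟨ cong +_ (Card-unique distants′ (Card-DistantPartition i n (s≤s z≤n)) id id) ⟩
      + distantCount i  ∎
      where
      distants′ : Card (DistantPartition (2 + e) (suc s) i n) c
      distants′ = subst (λ n′ → Card (DistantPartition (2 + e) (suc s) i n′) c) (m∸n+n≡m o≤n) distants
    by-cases (no o≰n) = begin
      phat i (n ⊖ o)          ≡⟨ cong (phat i) (ℤ.⊖-< (≰⇒> o≰n)) ⟩
      phat i (ℤ.- + (o ∸ n))  ≡⟨ phat-neg i (o ∸ n) (m<n⇒0<n∸m (≰⇒> o≰n)) ⟩
      + 0                     ≡⟨ cong +_ (Card-unique (Card-∅ no-distant) (Card-DistantPartition i n (s≤s z≤n)) id id) ⟩
      + distantCount i      ∎
      where
      no-distant : ∀ {z} → ¬ DistantPartition (2 + e) (suc s) i n z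
      no-distant h =
        o≰n (≤-trans (+-mono-≤ (*-monoˡ-≤ i (n≤1+n s)) (*-monoˡ-≤ (i C 2) (m≤n+m e 2))) (Distant-sum-≥ h))

parts-bounds : ∀ {d r n μ} → 1 ≤ n → μ ∈ distantPartitions d r n → 1 ≤ length μ × length μ ≤ n
parts-bounds {d} {r} {n} {μ} 1≤n μ∈
  with ∈-partitions⁻ (proj₁ (∈-filter⁻ (distantAbove? d r) {xs = partitions n} μ∈))
... | positive , _ , sum≡ =
  nonempty μ (subst (1 ≤_) (sym sum≡) 1≤n) , subst (length μ ≤_) sum≡ (length≤sum positive)
  where
  nonempty : ∀ μ → 1 ≤ sum μ → 1 ≤ length μ
  nonempty (_ ∷ _) _ = s≤s z≤n

corollary2 : (d r n : ℕ) → 2 ≤ d → 1 ≤ r → 1 ≤ n →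
    ∃ λ N → (M : ℕ) → N ≤ M →
      + p d n r ≡ sumFrom1 M (λ i → phat i (+ n ℤ.- + ((r ∸ 1) * i) ℤ.- + ((d ∸ 2) * (i C 2))))
corollary2 (suc zero) _ _ (s≤s ()) _ _
corollary2 (suc (suc e)) (suc s) n _ _ 1≤n = n , λ M n≤M → begin
  + p (2 + e) n (suc s)                         ≡⟨ length≡sum-counts length M _ (All.tabulate (bounds n≤M)) ⟩
  sumFrom1 M (λ i → + distantCount e s n i)   ≡⟨ sumFrom1-cong M (phat≡count e s n) ⟨
  sumFrom1 M (λ i → phat i (+ n ℤ.- + (s * i) ℤ.- + (e * (i C 2)))) ∎
  where
  open ≡-Reasoning
  bounds : ∀ {M μ} → n ≤ M → μ ∈ distantPartitions (2 + e) (suc s) n → 1 ≤ length μ × length μ ≤ M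
  bounds n≤M μ∈ with parts-bounds 1≤n μ∈
  ... | 1≤l , l≤n = 1≤l , ≤-trans l≤n n≤M
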